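{- Let $\ell>0$ and $b\neq0$ be integers with $\ell^2+4b\geq0$, and let $\mathbf{s}$ be defined by $s_0=0$, $s_1=1$, $s_j=\ell s_{j-1}+bs_{j-2}$ for $j\geq2$. Suppose $\gcd(\ell,b)=\gcd(\ell^2,b)$. If $b>0$, then $\mathcal{C}_n^{(\mathbf{s})}$ is not Gorenstein for all $n\geq5$; if $b<-1$, then $\mathcal{C}_n^{(\mathbf{s})}$ is not Gorenstein for all $n\geq6$.
   Context: $\mathcal{C}_n^{(\mathbf{s})}=\{\lambda\in\mathbb{R}^n: 0\leq\lambda_1/s_1\leq\cdots\leq\lambda_n/s_n\}$. A pointed rational cone $\mathcal{C}\subset\mathbb{R}^n$ is Gorenstein if there is an integer point $\mathbf{c}$ in the interior $\mathcal{C}^\circ$ such that $\mathcal{C}^\circ\cap\mathbb{Z}^n=\mathbf{c}+(\mathcal{C}\cap\mathbb{Z}^n)$. -}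

module Defs where

open import Data.Nat using (ℕ; zero; suc)
open import Data.Fin using (Fin; toℕ)
open import Data.Integer using (ℤ; _+_; _*_; _≤_; _<_; 0ℤ; 1ℤ)
open import Data.Product using (_×_; ∃; Σ)
open import Relation.Binary.PropositionalEquality using (_≡_)
open import Function.Bundles using (_⇔_)

seqS : ℤ → ℤ → ℕ → ℤ
seqS ℓ b zero = 0ℤ
seqS ℓ b (suc zero) = 1ℤ
seqS ℓ b (suc (suc j)) = ℓ * seqS ℓ b (suc j) + b * seqS ℓ b j

-- Points of ℤ^n are functions Fin n → ℤ; coordinate i : Fin n is the
-- paper's coordinate λ_{toℕ i + 1}, which is divided by s_{toℕ i + 1}.
-- The sequence s is positive at the indices used (s_j > 0 for j ≥ 1 under
-- the hypotheses), so λ_i/s_i ≤ λ_j/s_j is written as λ_i s_j ≤ λ_j s_i.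

-- Integer points of C_n^(s) : 0 ≤ λ_1/s_1 ≤ ... ≤ λ_n/s_n
InCone : (ℕ → ℤ) → (n : ℕ) → (Fin n → ℤ) → Set
InCone s n λv =
  (∀ (i : Fin n) → toℕ i ≡ 0 → 0ℤ ≤ λv i) ×
  (∀ (i j : Fin n) → suc (toℕ i) ≡ toℕ j →
     λv i * s (suc (toℕ j)) ≤ λv j * s (suc (toℕ i)))

-- Integer points of the interior: 0 < λ_1/s_1 < ... < λ_n/s_n
InInterior : (ℕ → ℤ) → (n : ℕ) → (Fin n → ℤ) → Set
InInterior s n λv =
  (∀ (i : Fin n) → toℕ i ≡ 0 → 0ℤ < λv i) ×
  (∀ (i j : Fin n) → suc (toℕ i) ≡ toℕ j →
     λv i * s (suc (toℕ j)) < λv j * s (suc (toℕ i)))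

IsGorenstein : (ℕ → ℤ) → (n : ℕ) → Set
IsGorenstein s n =
  Σ (Fin n → ℤ) λ c →
    InInterior s n c ×
    (∀ (x : Fin n → ℤ) →
       InInterior s n x ⇔
       (Σ (Fin n → ℤ) λ y → InCone s n y × (∀ i → x i ≡ c i + y i)))

-- Write ℓ = dL and b = dB with d = gcd(ℓ, b); the hypothesis gcd(ℓ, b) = gcd(ℓ², b) makes B
-- coprime to dL. With X = dL², the recurrence gives s₂ = dL, s₃ = d a₃, s₄ = d² L a₄, s₅ = d² a₅
-- and s₆ = d² a₆, where a₃ = X + B, a₄ = X + 2B, a₅ = X² + 3XB + B² and a₆ = dL a₃ (X + 3B).
--
-- If c is the Gorenstein point, then x − c lies in the cone for every interior integer point x,
-- so every facet functional attains its minimum over the interior integer points at c. Interior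
-- prefixes extend to interior points, and when s_{j+1} = gα and s_{j+2} = gβ with α, β coprime
-- there is an interior prefix whose j-th facet value is exactly g. The j-th facet value of c is a
-- positive multiple of g, hence equals g. Writing c for the coordinates (c_k = λ_{k+1}), this gives
-- a₃ c₃ − dL a₄ c₂ = 1 and L a₄ c₄ − a₅ c₃ = 1, and also a₅ c₅ − a₆ c₄ = 1 when n ≥ 6.
-- B times the first identity plus the second shows that a₄ divides B + 1, which is impossible for
-- B ≥ 1 and B ≤ −2 since then 0 < |B + 1| < a₄. For B = −1 (so d ≥ 2), d times the second minus
-- the third shows that a₅ divides d − 1, although 0 < d − 1 < a₅.

module Submission where

open import Defs
open import Data.Nat using (ℕ) renaming (_≤_ to _≤ℕ_)
open import Data.Integer using (ℤ; +_; -_; _+_; _*_; _≤_; _<_; 0ℤ)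
open import Data.Integer.GCD using (gcd)
open import Data.Product using (_×_)
open import Relation.Binary.PropositionalEquality using (_≡_)
open import Relation.Nullary using (¬_)

open import Data.Nat as ℕ using (zero; suc; z≤n; s≤s)
import Data.Nat.Properties as ℕₚ
import Data.Nat.GCD as ℕGCD
open import Data.Integer using (_-_; 1ℤ; ∣_∣; +≤+; +<+; -≤+; -[1+_]; positive; nonNegative; >-nonZero)
import Data.Integer.Properties as ℤₚ
open import Data.Integer.GCD using (gcd[i,j]∣i; gcd[i,j]∣j; gcd[i,j]≡0⇒i≡0)
import Data.Integer.Divisibility.Signed as Signed
open import Data.Integer.Tactic.RingSolver using (solve-∀)
open import Data.Empty using (⊥-elim)
open import Data.Fin using (Fin; toℕ; fromℕ<) renaming (zero to fzero; suc to fsuc)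
open import Data.Fin.Properties using (toℕ-fromℕ<; toℕ<n)
open import Data.Product using (_,_; proj₁; proj₂; Σ; ∃; ∃₂)
open import Data.Sum using (_⊎_; inj₁; inj₂)
open import Relation.Binary.Definitions using (tri<; tri≈; tri>)
open import Function using (_∘_; const)
open import Function.Bundles using (Equivalence)
open import Relation.Binary.PropositionalEquality
  using (_≢_; refl; sym; trans; cong; cong₂; subst; subst₂; module ≡-Reasoning)

*-pos : ∀ {i j} → 0ℤ < i → 0ℤ < j → 0ℤ < i * j
*-pos {i} 0<i 0<j =
  subst (_< i * _) (ℤₚ.*-zeroʳ i) (ℤₚ.*-monoˡ-<-pos i ⦃ positive 0<i ⦄ 0<j)

infixl 6 _⊕_
infixl 7 _⊛_

_⊕_ : ∀ {i j} → 0ℤ ≤ i → 0ℤ ≤ j → 0ℤ ≤ i + j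
_⊕_ = ℤₚ.+-mono-≤

_⊛_ : ∀ {i j} → 0ℤ ≤ i → 0ℤ ≤ j → 0ℤ ≤ i * j
_⊛_ {i} 0≤i 0≤j =
  subst (_≤ i * _) (ℤₚ.*-zeroʳ i) (ℤₚ.*-monoˡ-≤-nonNeg i ⦃ nonNegative 0≤i ⦄ 0≤j)

i≤i*j : ∀ {i j} → 0ℤ ≤ i → 1ℤ ≤ j → i ≤ i * j
i≤i*j {i} 0≤i 1≤j =
  subst (_≤ i * _) (ℤₚ.*-identityʳ i) (ℤₚ.*-monoˡ-≤-nonNeg i ⦃ nonNegative 0≤i ⦄ 1≤j)

i<j⇒0<j-i : ∀ {i j} → i < j → 0ℤ < j - i
i<j⇒0<j-i {i} {j} i<j = subst (_< j - i) (ℤₚ.+-inverseʳ i) (ℤₚ.+-monoˡ-< (- i) i<j)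

0<j-i⇒i<j : ∀ {i j} → 0ℤ < j - i → i < j
0<j-i⇒i<j {i} {j} 0<j-i = subst₂ _<_ (ℤₚ.+-identityˡ i) ([j-i]+i≡j i j) (ℤₚ.+-monoˡ-< i 0<j-i)
  where
  [j-i]+i≡j : ∀ i j → j - i + i ≡ j
  [j-i]+i≡j = solve-∀

0≤+ : ∀ n → 0ℤ ≤ + n
0≤+ n = +≤+ z≤n

0<-by : ∀ {i} t → 0ℤ ≤ t → i ≡ 1ℤ + t → 0ℤ < i
0<-by t 0≤t refl = ℤₚ.+-mono-<-≤ (+<+ (s≤s z≤n)) 0≤t

0≤i+∣i∣ : ∀ i → 0ℤ ≤ i + + ∣ i ∣
0≤i+∣i∣ (+ n)    = +≤+ z≤n
0≤i+∣i∣ -[1+ n ] = ℤₚ.≤-reflexive (sym (ℤₚ.n⊖n≡0 (suc n)))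

unit-factor : ∀ {g k} → 0ℤ < g → 0ℤ < g * k → g * k ≤ g → k ≡ 1ℤ
unit-factor {g} {k} 0<g 0<gk gk≤g = ℤₚ.≤-antisym k≤1 (ℤₚ.i<j⇒suc[i]≤j 0<k)
  where
  0<k : 0ℤ < k
  0<k = ℤₚ.*-cancelˡ-<-nonNeg g ⦃ nonNegative (ℤₚ.<⇒≤ 0<g) ⦄
          (subst (_< g * k) (sym (ℤₚ.*-zeroʳ g)) 0<gk)
  k≤1 : k ≤ 1ℤ
  k≤1 = ℤₚ.*-cancelˡ-≤-pos k 1ℤ g ⦃ positive 0<g ⦄
          (subst (g * k ≤_) (sym (ℤₚ.*-identityʳ g)) gk≤g)

¬*≡-between : ∀ {a k e} → 0ℤ < e → e < a → a * k ≢ e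
¬*≡-between {a} {k} {e} 0<e e<a ak≡e = ℤₚ.<⇒≱ e<a (begin
    a      ≡⟨ sym (ℤₚ.*-identityʳ a) ⟩
    a * 1ℤ ≤⟨ ℤₚ.*-monoˡ-≤-nonNeg a ⦃ nonNegative 0≤a ⦄ (ℤₚ.i<j⇒suc[i]≤j 0<k) ⟩
    a * k  ≡⟨ ak≡e ⟩
    e      ∎)
  where
  open ℤₚ.≤-Reasoning
  0≤a : 0ℤ ≤ a
  0≤a = ℤₚ.<⇒≤ (ℤₚ.<-trans 0<e e<a)
  0<k : 0ℤ < k
  0<k = ℤₚ.*-cancelˡ-<-nonNeg a ⦃ nonNegative 0≤a ⦄
          (subst₂ _<_ (sym (ℤₚ.*-zeroʳ a)) (sym ak≡e) 0<e)

-- Facet functionals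

toSeq : ∀ {n} → (Fin n → ℤ) → ℕ → ℤ
toSeq {zero}  x k       = 0ℤ
toSeq {suc n} x zero    = x fzero
toSeq {suc n} x (suc k) = toSeq (x ∘ fsuc) k

toSeq-toℕ : ∀ {n} (x : Fin n → ℤ) i → toSeq x (toℕ i) ≡ x i
toSeq-toℕ x fzero    = refl
toSeq-toℕ x (fsuc i) = toSeq-toℕ (x ∘ fsuc) i

toSeq-tabulate : ∀ {n} (x : ℕ → ℤ) {k} → k ℕ.< n → toSeq {n} (x ∘ toℕ) k ≡ x k
toSeq-tabulate {suc n} x {zero}  _         = refl
toSeq-tabulate {suc n} x {suc k} (s≤s k<n) = toSeq-tabulate {n} (x ∘ suc) k<n

toSeq-+ : ∀ {n} {x y z : Fin n → ℤ} → (∀ i → x i ≡ y i + z i) →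
          ∀ k → toSeq x k ≡ toSeq y k + toSeq z k
toSeq-+ {zero}  x≡y+z k       = refl
toSeq-+ {suc n} x≡y+z zero    = x≡y+z fzero
toSeq-+ {suc n} x≡y+z (suc k) = toSeq-+ (x≡y+z ∘ fsuc) k

-- For λ_{k+1} = x k this is s_{p+1} s_{p+2} (λ_{p+2}/s_{p+2} − λ_{p+1}/s_{p+1}).
facet : (ℕ → ℤ) → (ℕ → ℤ) → ℕ → ℤ
facet s x p = x (suc p) * s (suc p) - x p * s (suc (suc p))

facet-+ : ∀ s x y p → facet s (λ k → x k + y k) p ≡ facet s x p + facet s y p
facet-+ s x y p = lemma (x p) (x (suc p)) (y p) (y (suc p)) (s (suc p)) (s (suc (suc p)))
  where
  lemma : ∀ x₀ x₁ y₀ y₁ s₁ s₂ →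
          (x₁ + y₁) * s₁ - (x₀ + y₀) * s₂ ≡ (x₁ * s₁ - x₀ * s₂) + (y₁ * s₁ - y₀ * s₂)
  lemma = solve-∀

facet-scale-shift : ∀ s x α β p →
  facet s (λ k → α * x k + β * s (suc k)) p ≡ α * facet s x p
facet-scale-shift s x α β p = lemma α β (x p) (x (suc p)) (s (suc p)) (s (suc (suc p)))
  where
  lemma : ∀ α β x₀ x₁ s₁ s₂ →
          (α * x₁ + β * s₂) * s₁ - (α * x₀ + β * s₁) * s₂ ≡ α * (x₁ * s₁ - x₀ * s₂)
  lemma = solve-∀

facet-agree : ∀ s x y p → x p ≡ y p → x (suc p) ≡ y (suc p) → facet s x p ≡ facet s y p
facet-agree s x y p x₀≡y₀ x₁≡y₁ =
  cong₂ (λ a b → a * s (suc p) - b * s (suc (suc p))) x₁≡y₁ x₀≡y₀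

facet-common-factor : ∀ s x p g α β → s (suc p) ≡ g * α → s (suc (suc p)) ≡ g * β →
  facet s x p ≡ g * (α * x (suc p) - β * x p)
facet-common-factor s x p g α β s₁≡ s₂≡ = begin
  x (suc p) * s (suc p) - x p * s (suc (suc p)) ≡⟨ cong₂ (λ a b → x (suc p) * a - x p * b) s₁≡ s₂≡ ⟩
  x (suc p) * (g * α) - x p * (g * β)           ≡⟨ lemma g α β (x p) (x (suc p)) ⟩
  g * (α * x (suc p) - β * x p)                 ∎
  where
  open ≡-Reasoning
  lemma : ∀ g α β x₀ x₁ → x₁ * (g * α) - x₀ * (g * β) ≡ g * (α * x₁ - β * x₀)
  lemma = solve-∀

adjacent⇒facet : ∀ {n} (s : ℕ → ℤ) (x : Fin n → ℤ) (R : ℤ → ℤ → Set) →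
  (∀ (i j : Fin n) → suc (toℕ i) ≡ toℕ j → R (x i * s (suc (toℕ j))) (x j * s (suc (toℕ i)))) →
  ∀ {p} → suc p ℕ.< n → R (toSeq x p * s (suc (suc p))) (toSeq x (suc p) * s (suc p))
adjacent⇒facet {n} s x R adjacent {p} p+1<n =
  subst₂ R (cong₂ _*_ (value i p-eq) (cong (s ∘ suc) q-eq))
           (cong₂ _*_ (value j q-eq) (cong (s ∘ suc) p-eq))
           (adjacent i j (trans (cong suc p-eq) (sym q-eq)))
  where
  p<n : p ℕ.< n
  p<n = ℕₚ.<-trans (ℕₚ.n<1+n p) p+1<n
  i j : Fin n
  i = fromℕ< p<n
  j = fromℕ< p+1<n
  p-eq : toℕ i ≡ p
  p-eq = toℕ-fromℕ< p<n
  q-eq : toℕ j ≡ suc p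
  q-eq = toℕ-fromℕ< p+1<n
  value : ∀ k {m} → toℕ k ≡ m → x k ≡ toSeq x m
  value k refl = sym (toSeq-toℕ x k)

interior⇒0<facet : ∀ {s n c} → InInterior s n c → ∀ {p} → suc p ℕ.< n → 0ℤ < facet s (toSeq c) p
interior⇒0<facet {s} {c = c} (_ , adjacent) p+1<n =
  i<j⇒0<j-i (adjacent⇒facet s c _<_ adjacent p+1<n)

cone⇒0≤facet : ∀ {s n y} → InCone s n y → ∀ {p} → suc p ℕ.< n → 0ℤ ≤ facet s (toSeq y) p
cone⇒0≤facet {s} {y = y} (_ , adjacent) p+1<n =
  ℤₚ.i≤j⇒0≤j-i (adjacent⇒facet s y _≤_ adjacent p+1<n)

facets⇒interior : ∀ {s n} (x : ℕ → ℤ) → 0ℤ < x 0 →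
  (∀ {p} → suc p ℕ.< n → 0ℤ < facet s x p) → InInterior s n (x ∘ toℕ)
facets⇒interior {s} {n} x 0<x₀ 0<facet =
  (λ i i≡0 → subst (λ k → 0ℤ < x k) (sym i≡0) 0<x₀) ,
  (λ i j i+1≡j → subst (λ k → x (toℕ i) * s (suc k) < x k * s (suc (toℕ i))) i+1≡j
                   (0<j-i⇒i<j (0<facet (subst (ℕ._< n) (sym i+1≡j) (toℕ<n j)))))

splice : ℕ → (ℕ → ℤ) → (ℕ → ℤ) → ℕ → ℤ
splice zero    f g k       = g k
splice (suc m) f g zero    = f zero
splice (suc m) f g (suc k) = splice m (f ∘ suc) (g ∘ suc) k

splice-< : ∀ m f g {k} → k ℕ.< m → splice m f g k ≡ f k
splice-< (suc m) f g {zero}  _         = refl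
splice-< (suc m) f g {suc k} (s≤s k<m) = splice-< m (f ∘ suc) (g ∘ suc) k<m

splice-≥ : ∀ m f g {k} → m ℕ.≤ k → splice m f g k ≡ g k
splice-≥ zero    f g _         = refl
splice-≥ (suc m) f g (s≤s m≤k) = splice-≥ m (f ∘ suc) (g ∘ suc) m≤k

facet-splice-< : ∀ s m f g {p} → suc p ℕ.< m → facet s (splice m f g) p ≡ facet s f p
facet-splice-< s m f g {p} p+1<m = facet-agree s (splice m f g) f p
  (splice-< m f g (ℕₚ.<-trans (ℕₚ.n<1+n p) p+1<m)) (splice-< m f g p+1<m)

facet-splice-≥ : ∀ s m f g {p} → m ℕ.≤ p → facet s (splice m f g) p ≡ facet s g p
facet-splice-≥ s m f g {p} m≤p = facet-agree s (splice m f g) g p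
  (splice-≥ m f g m≤p) (splice-≥ m f g (ℕₚ.m≤n⇒m≤1+n m≤p))

facet-splice-boundary : ∀ s f g p →
  facet s (splice (suc p) f g) p ≡ g (suc p) * s (suc p) - f p * s (suc (suc p))
facet-splice-boundary s f g p =
  cong₂ (λ a b → a * s (suc p) - b * s (suc (suc p)))
        (splice-≥ (suc p) f g ℕₚ.≤-refl) (splice-< (suc p) f g ℕₚ.≤-refl)

0<i+[1+∣i∣]*j : ∀ i {j} → 0ℤ < j → 0ℤ < i + (1ℤ + + ∣ i ∣) * j
0<i+[1+∣i∣]*j i {j} 0<j = begin-strict
  0ℤ                     ≤⟨ 0≤i+∣i∣ i ⟩
  i + + ∣ i ∣            <⟨ ℤₚ.+-monoʳ-< i (ℤₚ.suc[i]≤j⇒i<j ℤₚ.≤-refl) ⟩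
  i + (1ℤ + + ∣ i ∣)     ≤⟨ ℤₚ.+-monoʳ-≤ i (i≤i*j (+≤+ z≤n) (ℤₚ.i<j⇒suc[i]≤j 0<j)) ⟩
  i + (1ℤ + + ∣ i ∣) * j ∎
  where open ℤₚ.≤-Reasoning

-- Minimality of the Gorenstein point

-- The tail α c + β s_{·+1} has α times the facet values of c, and N is large enough to make the
-- facet at the junction with the prefix z positive.
module Extension (s c z : ℕ → ℤ) (m : ℕ) where

  gap : ℤ
  gap = c (suc m) * s (suc m) - z m * s (suc (suc m))

  N : ℤ
  N = 1ℤ + + ∣ gap ∣

  0≤N : 0ℤ ≤ N
  0≤N = +≤+ z≤n

  α β : ℤ
  α = 1ℤ + N * s (suc m)
  β = - (N * c m)

  tail : ℕ → ℤ
  tail k = α * c k + β * s (suc k)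

  extension : ℕ → ℤ
  extension = splice (suc m) z tail

  facet-boundary : facet s extension m ≡ gap + N * (facet s c m * s (suc m))
  facet-boundary = trans (facet-splice-boundary s z tail m)
    (lemma N (c m) (c (suc m)) (z m) (s (suc m)) (s (suc (suc m))))
    where
    lemma : ∀ N c₀ c₁ z₀ s₁ s₂ →
      ((1ℤ + N * s₁) * c₁ + (- (N * c₀)) * s₂) * s₁ - z₀ * s₂
        ≡ (c₁ * s₁ - z₀ * s₂) + N * ((c₁ * s₁ - c₀ * s₂) * s₁)
    lemma = solve-∀

  extension-interior : ∀ {n} → 0ℤ < s (suc m) → 0ℤ < z 0 →
    (∀ {p} → p ℕ.< m → 0ℤ < facet s z p) →
    (∀ {p} → suc p ℕ.< n → 0ℤ < facet s c p) →
    InInterior s n (extension ∘ toℕ)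
  extension-interior {n} 0<sₘ₊₁ 0<z₀ z-facets c-facets = facets⇒interior {s} extension 0<z₀ facets
    where
    facets : ∀ {p} → suc p ℕ.< n → 0ℤ < facet s extension p
    facets {p} p+1<n with ℕₚ.<-cmp p m
    ... | tri< p<m _ _ = subst (0ℤ <_) (sym (facet-splice-< s (suc m) z tail (s≤s p<m))) (z-facets p<m)
    ... | tri≈ _ refl _ = subst (0ℤ <_) (sym facet-boundary)
                            (0<i+[1+∣i∣]*j gap (*-pos (c-facets p+1<n) 0<sₘ₊₁))
    ... | tri> _ _ m<p = subst (0ℤ <_)
                           (sym (trans (facet-splice-≥ s (suc m) z tail m<p)
                                       (facet-scale-shift s c α β p)))
                           (*-pos (0<-by (N * s (suc m)) (0≤N ⊛ ℤₚ.<⇒≤ 0<sₘ₊₁) refl) (c-facets p+1<n))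

gorenstein-point-minimal : ∀ {s n} (G : IsGorenstein s n) {m} → suc m ℕ.≤ n → 0ℤ < s (suc m) →
  (z : ℕ → ℤ) → 0ℤ < z 0 → (∀ {p} → p ℕ.< m → 0ℤ < facet s z p) →
  ∀ {p} → p ℕ.< m → facet s (toSeq (proj₁ G)) p ≤ facet s z p
gorenstein-point-minimal {s} {n} (c , c° , c°≡c+cone) {m} m<n 0<sₘ₊₁ z 0<z₀ z-facets {p} p<m = begin
    facet s (toSeq c) p                       ≤⟨ ℤₚ.i≤i+j (facet s (toSeq c) p) (facet s (toSeq y) p)
                                                   ⦃ nonNegative (cone⇒0≤facet {s} y-cone p+1<n) ⦄ ⟩
    facet s (toSeq c) p + facet s (toSeq y) p ≡⟨ facet-+ s (toSeq c) (toSeq y) p ⟨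
    facet s (λ k → toSeq c k + toSeq y k) p   ≡⟨ facet-agree s (λ k → toSeq c k + toSeq y k) z p
                                                   (c+y≡z (ℕₚ.m<n⇒m<1+n p<m)) (c+y≡z (s≤s p<m)) ⟩
    facet s z p                               ∎
  where
  open ℤₚ.≤-Reasoning
  open Extension s (toSeq c) z m
  decomposition : Σ (Fin n → ℤ) λ y → InCone s n y × (∀ i → extension (toℕ i) ≡ c i + y i)
  decomposition = Equivalence.to (c°≡c+cone (extension ∘ toℕ))
                    (extension-interior {n} 0<sₘ₊₁ 0<z₀ z-facets (interior⇒0<facet {s} c°))
  y : Fin n → ℤ
  y = proj₁ decomposition
  y-cone : InCone s n y
  y-cone = proj₁ (proj₂ decomposition)
  p+1<n : suc p ℕ.< n
  p+1<n = ℕₚ.<-≤-trans (s≤s p<m) m<n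
  c+y≡z : ∀ {k} → k ℕ.< suc m → toSeq c k + toSeq y k ≡ z k
  c+y≡z {k} k<m+1 = begin-equality
    toSeq c k + toSeq y k         ≡⟨ toSeq-+ {x = extension ∘ toℕ} (proj₂ (proj₂ decomposition)) k ⟨
    toSeq {n} (extension ∘ toℕ) k ≡⟨ toSeq-tabulate extension (ℕₚ.<-≤-trans k<m+1 m<n) ⟩
    extension k                   ≡⟨ splice-< (suc m) z tail k<m+1 ⟩
    z k                           ∎

record BézoutCoprime (a m : ℤ) : Set where
  constructor bézout
  field
    u v      : ℤ
    identity : a * u + m * v ≡ 1ℤ

coprime-sym : ∀ {a m} → BézoutCoprime a m → BézoutCoprime m a
coprime-sym {a} {m} (bézout u v au+mv≡1) = bézout v u (trans (ℤₚ.+-comm (m * v) (a * u)) au+mv≡1)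

1-coprime : ∀ m → BézoutCoprime 1ℤ m
1-coprime m = bézout 1ℤ 0ℤ (lemma m)
  where
  lemma : ∀ m → 1ℤ * 1ℤ + m * 0ℤ ≡ 1ℤ
  lemma = solve-∀

coprime-neg : ∀ {a m} → BézoutCoprime a m → BézoutCoprime (- a) m
coprime-neg {a} {m} (bézout u v au+mv≡1) = bézout (- u) v (trans (lemma a m u v) au+mv≡1)
  where
  lemma : ∀ a m u v → (- a) * (- u) + m * v ≡ a * u + m * v
  lemma = solve-∀

coprime-+* : ∀ {a m} t → BézoutCoprime a m → BézoutCoprime (a + m * t) m
coprime-+* {a} {m} t (bézout u v au+mv≡1) = bézout u (v - t * u) (trans (lemma a m t u v) au+mv≡1)
  where
  lemma : ∀ a m t u v → (a + m * t) * u + m * (v - t * u) ≡ a * u + m * v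
  lemma = solve-∀

coprime-*ˡ : ∀ {a b m} → BézoutCoprime a m → BézoutCoprime b m → BézoutCoprime (a * b) m
coprime-*ˡ {a} {b} {m} (bézout u v au+mv≡1) (bézout w t bw+mt≡1) =
  bézout (u * w) (v * (b * w) + a * u * t + m * v * t)
         (trans (lemma a b m u v w t) (cong₂ _*_ au+mv≡1 bw+mt≡1))
  where
  lemma : ∀ a b m u v w t →
    a * b * (u * w) + m * (v * (b * w) + a * u * t + m * v * t) ≡ (a * u + m * v) * (b * w + m * t)
  lemma = solve-∀

coprime-*ʳ : ∀ {a m n} → BézoutCoprime a m → BézoutCoprime a n → BézoutCoprime a (m * n)
coprime-*ʳ {a} {m} {n} (bézout u v au+mv≡1) (bézout w t aw+nt≡1) =
  bézout (u * (a * w) + u * n * t + m * v * w) (v * t)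
         (trans (lemma a m n u v w t) (cong₂ _*_ au+mv≡1 aw+nt≡1))
  where
  lemma : ∀ a m n u v w t →
    a * (u * (a * w) + u * n * t + m * v * w) + m * n * (v * t) ≡ (a * u + m * v) * (a * w + n * t)
  lemma = solve-∀

coprime-respˡ : ∀ {a b m} → a ≡ b → BézoutCoprime a m → BézoutCoprime b m
coprime-respˡ {m = m} = subst (λ a → BézoutCoprime a m)

coprime-*⇒coprimeˡ : ∀ {a} m n → BézoutCoprime a (m * n) → BézoutCoprime a m
coprime-*⇒coprimeˡ {a} m n (bézout u v eq) =
  bézout u (n * v) (trans (cong (λ w → a * u + w) (sym (ℤₚ.*-assoc m n v))) eq)

coprime-*⇒coprimeʳ : ∀ {a} m n → BézoutCoprime a (m * n) → BézoutCoprime a n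
coprime-*⇒coprimeʳ {a} m n = coprime-*⇒coprimeˡ n m ∘ subst (BézoutCoprime a) (ℤₚ.*-comm m n)

-- Interior prefixes with a prescribed facet

i≤∣i∣ : ∀ i → i ≤ + ∣ i ∣
i≤∣i∣ (+ n)    = ℤₚ.≤-refl
i≤∣i∣ -[1+ n ] = -≤+

archimedean : ∀ {m} a t → 0ℤ < m → ∃ λ k → t < k * m + a
archimedean {m} a t 0<m = k , (begin-strict
  t                               ≤⟨ i≤∣i∣ t ⟩
  + ∣ t ∣                         <⟨ ℤₚ.suc[i]≤j⇒i<j ℤₚ.≤-refl ⟩
  1ℤ + + ∣ t ∣                    ≤⟨ ℤₚ.i≤i+j _ _ ⦃ nonNegative (0≤i+∣i∣ a) ⦄ ⟩
  1ℤ + + ∣ t ∣ + (a + + ∣ a ∣)    ≡⟨ lemma a (+ ∣ t ∣) (+ ∣ a ∣) ⟩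
  k + a                           ≤⟨ ℤₚ.+-monoˡ-≤ a (i≤i*j (+≤+ z≤n) (ℤₚ.i<j⇒suc[i]≤j 0<m)) ⟩
  k * m + a                       ∎)
  where
  open ℤₚ.≤-Reasoning
  k : ℤ
  k = 1ℤ + + ∣ t ∣ + + ∣ a ∣
  lemma : ∀ a t′ a′ → 1ℤ + t′ + (a + a′) ≡ 1ℤ + t′ + a′ + a
  lemma = solve-∀

PositiveOn : (ℕ → ℤ) → ℕ → Set
PositiveOn s m = ∀ {k} → k ℕ.< m → 0ℤ < s (suc k)

positiveOn-≤ : ∀ {s m m′} → m ℕ.≤ m′ → PositiveOn s m′ → PositiveOn s m
positiveOn-≤ m≤m′ pos k<m = pos (ℕₚ.<-≤-trans k<m m≤m′)

staircase : (ℕ → ℤ) → ℕ → ℤ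
staircase s zero    = 1ℤ
staircase s (suc k) = staircase s k * s (suc (suc k)) + 1ℤ

staircase-nonNeg : ∀ {s} k → PositiveOn s (suc k) → 0ℤ ≤ staircase s k
staircase-nonNeg     zero    _   = 0≤+ 1
staircase-nonNeg {s} (suc k) pos =
  staircase-nonNeg k (positiveOn-≤ {s} (ℕₚ.n≤1+n _) pos) ⊛ ℤₚ.<⇒≤ (pos ℕₚ.≤-refl) ⊕ 0≤+ 1

staircase-facet : ∀ {s} k → PositiveOn s (suc (suc k)) → 0ℤ < facet s (staircase s) k
staircase-facet {s} k pos = subst (0ℤ <_) (sym (lemma g (s (suc k)) (s (suc (suc k)))))
  (ℤₚ.+-mono-<-≤ 0<s₁ (0≤g ⊛ 0≤s₂ ⊛ ℤₚ.i≤j⇒0≤j-i (ℤₚ.i<j⇒suc[i]≤j 0<s₁)))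
  where
  g = staircase s k
  0≤g : 0ℤ ≤ g
  0≤g = staircase-nonNeg k (positiveOn-≤ {s} (ℕₚ.n≤1+n _) pos)
  0<s₁ : 0ℤ < s (suc k)
  0<s₁ = pos (ℕₚ.m<n⇒m<1+n (ℕₚ.n<1+n k))
  0≤s₂ : 0ℤ ≤ s (suc (suc k))
  0≤s₂ = ℤₚ.<⇒≤ (pos ℕₚ.≤-refl)
  lemma : ∀ g s₁ s₂ → (g * s₂ + 1ℤ) * s₁ - g * s₂ ≡ s₁ + g * s₂ * (s₁ - 1ℤ)
  lemma = solve-∀

-- The staircase keeps the first facets positive; the Bézout pair, shifted by a large multiple
-- of (β, α), sets facet q + 1 to g and makes facet q positive.
prescribed-facet : ∀ s q {g α β} → PositiveOn s (suc (suc q)) → 0ℤ < α →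
  s (suc (suc q)) ≡ g * α → s (suc (suc (suc q))) ≡ g * β → BézoutCoprime α β →
  ∃ λ z → 0ℤ < z 0 × (∀ {p} → p ℕ.< suc q → 0ℤ < facet s z p) × facet s z (suc q) ≡ g
prescribed-facet s q {g} {α} {β} pos 0<α sα sβ (bézout u v αu+βv≡1) =
  z , +<+ (s≤s z≤n) , facets , top
  where
  shift = archimedean (- v) (staircase s q * s (suc (suc q))) 0<α
  k = proj₁ shift
  lower upper : ℤ
  lower = k * α - v
  upper = u + k * β
  below : ℕ → ℤ
  below = splice (suc q) (staircase s) (const lower)
  z : ℕ → ℤ
  z = splice (suc (suc q)) below (const upper)

  boundary : 0ℤ < facet s below q
  boundary = subst (0ℤ <_) (sym (facet-splice-boundary s (staircase s) (const lower) q))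
    (i<j⇒0<j-i (ℤₚ.<-≤-trans (proj₂ shift) (i≤i*j 0≤lower (ℤₚ.i<j⇒suc[i]≤j 0<s₍q+1₎))))
    where
    0<s₍q+1₎ : 0ℤ < s (suc q)
    0<s₍q+1₎ = pos (ℕₚ.m<n⇒m<1+n (ℕₚ.n<1+n q))
    0≤lower : 0ℤ ≤ lower
    0≤lower = ℤₚ.<⇒≤ (ℤₚ.≤-<-trans
      (staircase-nonNeg q (positiveOn-≤ {s} (ℕₚ.n≤1+n _) pos) ⊛ ℤₚ.<⇒≤ (pos ℕₚ.≤-refl))
      (proj₂ shift))

  facets : ∀ {p} → p ℕ.< suc q → 0ℤ < facet s z p
  facets {p} p<q+1 =
    subst (0ℤ <_) (sym (facet-splice-< s (suc (suc q)) below (const upper) (s≤s p<q+1)))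
      (facets-below (ℕₚ.m<1+n⇒m<n∨m≡n p<q+1))
    where
    facets-below : p ℕ.< q ⊎ p ≡ q → 0ℤ < facet s below p
    facets-below (inj₁ p<q) =
      subst (0ℤ <_) (sym (facet-splice-< s (suc q) (staircase s) (const lower) (s≤s p<q)))
        (staircase-facet p (positiveOn-≤ {s} (ℕₚ.m≤n⇒m≤1+n (s≤s p<q)) pos))
    facets-below (inj₂ refl) = boundary

  top : facet s z (suc q) ≡ g
  top = begin
    facet s z (suc q)                             ≡⟨ facet-common-factor s z (suc q) g α β sα sβ ⟩
    g * (α * z (suc (suc q)) - β * z (suc q))     ≡⟨ cong₂ (λ a b → g * (α * a - β * b)) z-upper z-lower ⟩
    g * (α * upper - β * lower)                   ≡⟨ cong (g *_) (trans (lemma α β u v k) αu+βv≡1) ⟩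
    g * 1ℤ                                        ≡⟨ ℤₚ.*-identityʳ g ⟩
    g                                             ∎
    where
    open ≡-Reasoning
    lemma : ∀ α β u v k → α * (u + k * β) - β * (k * α - v) ≡ α * u + β * v
    lemma = solve-∀
    z-upper : z (suc (suc q)) ≡ upper
    z-upper = splice-≥ (suc (suc q)) below (const upper) ℕₚ.≤-refl
    z-lower : z (suc q) ≡ lower
    z-lower = trans (splice-< (suc (suc q)) below (const upper) ℕₚ.≤-refl)
                    (splice-≥ (suc q) (staircase s) (const lower) ℕₚ.≤-refl)

gorenstein⇒unit-facet : ∀ {s n} q {g α β} → PositiveOn s (suc (suc (suc q))) → 0ℤ < g → 0ℤ < α →
  s (suc (suc q)) ≡ g * α → s (suc (suc (suc q))) ≡ g * β → BézoutCoprime α β →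
  (G : IsGorenstein s n) → suc (suc (suc q)) ℕ.≤ n →
  α * toSeq (proj₁ G) (suc (suc q)) - β * toSeq (proj₁ G) (suc q) ≡ 1ℤ
gorenstein⇒unit-facet {s} q {g} {α} {β} pos 0<g 0<α sα sβ α⊥β G@(c , c° , _) q+3≤n =
  unit-factor {g} {α * toSeq c (suc (suc q)) - β * toSeq c (suc q)} 0<g
    (subst (0ℤ <_) factor (interior⇒0<facet {s} c° q+3≤n))
    (subst₂ _≤_ factor z-top
      (gorenstein-point-minimal {s} G q+3≤n (pos ℕₚ.≤-refl) z 0<z₀ z-facets′ ℕₚ.≤-refl))
  where
  factor : facet s (toSeq c) (suc q) ≡ g * (α * toSeq c (suc (suc q)) - β * toSeq c (suc q))
  factor = facet-common-factor s (toSeq c) (suc q) g α β sα sβ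
  prescribed = prescribed-facet s q (positiveOn-≤ {s} (ℕₚ.n≤1+n _) pos) 0<α sα sβ α⊥β
  z : ℕ → ℤ
  z = proj₁ prescribed
  0<z₀ : 0ℤ < z 0
  0<z₀ = proj₁ (proj₂ prescribed)
  z-top : facet s z (suc q) ≡ g
  z-top = proj₂ (proj₂ (proj₂ prescribed))
  z-facets′ : ∀ {p} → p ℕ.< suc (suc q) → 0ℤ < facet s z p
  z-facets′ p<q+2 with ℕₚ.m<1+n⇒m<n∨m≡n p<q+2
  ... | inj₁ p<q+1 = proj₁ (proj₂ (proj₂ prescribed)) p<q+1
  ... | inj₂ refl  = subst (0ℤ <_) (sym z-top) 0<g

-- The sequence for ℓ = dL and b = dB

module Recurrence (d L B : ℤ) where

  X a₃ a₄ a₅ a₆ : ℤ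
  X  = d * L * L
  a₃ = X + B
  a₄ = X + + 2 * B
  a₅ = X * X + + 3 * X * B + B * B
  a₆ = d * L * a₃ * (X + + 3 * B)

  s : ℕ → ℤ
  s = seqS (d * L) (d * B)

  private
    step : ∀ k {x y} → s (suc k) ≡ x → s k ≡ y → s (suc (suc k)) ≡ d * L * x + d * B * y
    step k = cong₂ (λ x y → d * L * x + d * B * y)

  s₂ : s 2 ≡ d * L
  s₂ = lemma d L B
    where
    lemma : ∀ d L B → d * L * 1ℤ + d * B * 0ℤ ≡ d * L
    lemma = solve-∀

  s₃ : s 3 ≡ d * a₃
  s₃ = trans (step 1 s₂ refl) (lemma d L B)
    where
    lemma : ∀ d L B → d * L * (d * L) + d * B * 1ℤ ≡ d * (d * L * L + B)
    lemma = solve-∀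

  s₄ : s 4 ≡ d * d * (L * a₄)
  s₄ = trans (step 2 s₃ s₂) (lemma d L X B)
    where
    lemma : ∀ d L X B → d * L * (d * (X + B)) + d * B * (d * L) ≡ d * d * (L * (X + + 2 * B))
    lemma = solve-∀

  s₅ : s 5 ≡ d * d * a₅
  s₅ = trans (step 3 s₄ s₃) (lemma d L B)
    where
    lemma : ∀ d L B →
      d * L * (d * d * (L * (d * L * L + + 2 * B))) + d * B * (d * (d * L * L + B))
        ≡ d * d * ((d * L * L) * (d * L * L) + + 3 * (d * L * L) * B + B * B)
    lemma = solve-∀

  s₆ : s 6 ≡ d * d * a₆
  s₆ = trans (step 4 s₅ s₄) (lemma d L X B)
    where
    lemma : ∀ d L X B →
      d * L * (d * d * (X * X + + 3 * X * B + B * B)) + d * B * (d * d * (L * (X + + 2 * B)))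
        ≡ d * d * (d * L * (X + B) * (X + + 3 * B))
    lemma = solve-∀

  module UnitFacets (0<d : 0ℤ < d) (0<L : 0ℤ < L) (0<a₃ : 0ℤ < a₃) (0<a₄ : 0ℤ < a₄) (0<a₅ : 0ℤ < a₅)
    where

    0<d² : 0ℤ < d * d
    0<d² = *-pos 0<d 0<d

    s-positive : PositiveOn s 5
    s-positive {0}     _ = +<+ (s≤s z≤n)
    s-positive {1}     _ = subst (0ℤ <_) (sym s₂) (*-pos 0<d 0<L)
    s-positive {2}     _ = subst (0ℤ <_) (sym s₃) (*-pos 0<d 0<a₃)
    s-positive {3}     _ = subst (0ℤ <_) (sym s₄) (*-pos 0<d² (*-pos 0<L 0<a₄))
    s-positive {4}     _ = subst (0ℤ <_) (sym s₅) (*-pos 0<d² 0<a₅)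
    s-positive {suc (suc (suc (suc (suc k))))} (s≤s (s≤s (s≤s (s≤s (s≤s ())))))

    unit-facet₂ : BézoutCoprime a₃ (d * L * a₄) → ∀ {n} (G : IsGorenstein s n) → 4 ℕ.≤ n →
      a₃ * toSeq (proj₁ G) 3 - d * L * a₄ * toSeq (proj₁ G) 2 ≡ 1ℤ
    unit-facet₂ a₃⊥dLa₄ G 4≤n =
      gorenstein⇒unit-facet {s} 1 (positiveOn-≤ {s} (ℕₚ.n≤1+n _) s-positive)
        0<d 0<a₃ s₃ (trans s₄ (lemma d L a₄)) a₃⊥dLa₄ G 4≤n
      where
      lemma : ∀ d L a → d * d * (L * a) ≡ d * (d * L * a)
      lemma = solve-∀

    unit-facet₃ : BézoutCoprime (L * a₄) a₅ → ∀ {n} (G : IsGorenstein s n) → 5 ℕ.≤ n →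
      L * a₄ * toSeq (proj₁ G) 4 - a₅ * toSeq (proj₁ G) 3 ≡ 1ℤ
    unit-facet₃ La₄⊥a₅ G 5≤n =
      gorenstein⇒unit-facet {s} 2 s-positive 0<d² (*-pos 0<L 0<a₄) s₄ s₅ La₄⊥a₅ G 5≤n

    unit-facet₄ : 0ℤ < a₆ → BézoutCoprime a₅ a₆ → ∀ {n} (G : IsGorenstein s n) → 6 ℕ.≤ n →
      a₅ * toSeq (proj₁ G) 5 - a₆ * toSeq (proj₁ G) 4 ≡ 1ℤ
    unit-facet₄ 0<a₆ a₅⊥a₆ G 6≤n =
      gorenstein⇒unit-facet {s} 3 s-positive′ 0<d² 0<a₅ s₅ s₆ a₅⊥a₆ G 6≤n
      where
      s-positive′ : PositiveOn s 6
      s-positive′ k<6 with ℕₚ.m<1+n⇒m<n∨m≡n k<6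
      ... | inj₁ k<5 = s-positive k<5
      ... | inj₂ refl = subst (0ℤ <_) (sym s₆) (*-pos 0<d² 0<a₆)

  module Coprimality (B⊥dL : BézoutCoprime B (d * L)) where

    private
      B⊥d : BézoutCoprime B d
      B⊥d = coprime-*⇒coprimeˡ d L B⊥dL

      B⊥L : BézoutCoprime B L
      B⊥L = coprime-*⇒coprimeʳ d L B⊥dL

      a₄⊥B : BézoutCoprime a₄ B
      a₄⊥B = coprime-respˡ (lemma d L B)
        (coprime-+* (+ 2) (coprime-*ˡ (coprime-sym B⊥dL) (coprime-sym B⊥L)))
        where
        lemma : ∀ d L B → d * L * L + B * + 2 ≡ d * L * L + + 2 * B
        lemma = solve-∀

      B⊥a₄ : BézoutCoprime B a₄
      B⊥a₄ = coprime-sym a₄⊥B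

    a₃⊥dLa₄ : BézoutCoprime a₃ (d * L * a₄)
    a₃⊥dLa₄ = coprime-*ʳ (coprime-*ʳ a₃⊥d a₃⊥L) a₃⊥a₄
      where
      a₃⊥d : BézoutCoprime a₃ d
      a₃⊥d = coprime-respˡ (lemma d L B) (coprime-+* (L * L) B⊥d)
        where
        lemma : ∀ d L B → B + d * (L * L) ≡ d * L * L + B
        lemma = solve-∀
      a₃⊥L : BézoutCoprime a₃ L
      a₃⊥L = coprime-respˡ (lemma d L B) (coprime-+* (d * L) B⊥L)
        where
        lemma : ∀ d L B → B + L * (d * L) ≡ d * L * L + B
        lemma = solve-∀
      a₃⊥a₄ : BézoutCoprime a₃ a₄
      a₃⊥a₄ = coprime-respˡ (lemma X B) (coprime-+* 1ℤ (coprime-neg B⊥a₄))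
        where
        lemma : ∀ X B → - B + (X + + 2 * B) * 1ℤ ≡ X + B
        lemma = solve-∀

    La₄⊥a₅ : BézoutCoprime (L * a₄) a₅
    La₄⊥a₅ = coprime-sym (coprime-*ʳ a₅⊥L a₅⊥a₄)
      where
      a₅⊥L : BézoutCoprime a₅ L
      a₅⊥L = coprime-respˡ (lemma d L B)
        (coprime-+* (d * d * L * L * L + + 3 * d * L * B) (coprime-*ˡ B⊥L B⊥L))
        where
        lemma : ∀ d L B → B * B + L * (d * d * L * L * L + + 3 * d * L * B)
                          ≡ (d * L * L) * (d * L * L) + + 3 * (d * L * L) * B + B * B
        lemma = solve-∀
      a₅⊥a₄ : BézoutCoprime a₅ a₄
      a₅⊥a₄ = coprime-respˡ (lemma X B) (coprime-+* a₃ (coprime-neg (coprime-*ˡ B⊥a₄ B⊥a₄)))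
        where
        lemma : ∀ X B → - (B * B) + (X + + 2 * B) * (X + B) ≡ X * X + + 3 * X * B + B * B
        lemma = solve-∀

  not-gorenstein : 0ℤ < d → 0ℤ < L → 0ℤ < a₃ → 0ℤ < a₄ → 0ℤ < a₅ → BézoutCoprime B (d * L) →
    (∀ k → a₄ * k ≢ B + 1ℤ) → ∀ n → 5 ℕ.≤ n → ¬ IsGorenstein s n
  not-gorenstein 0<d 0<L 0<a₃ 0<a₄ 0<a₅ B⊥dL a₄∤B+1 n 5≤n G@(c , _) =
    a₄∤B+1 (L * c′ 4 - B * d * L * c′ 2 - X * c′ 3) (begin
      a₄ * (L * c′ 4 - B * d * L * c′ 2 - X * c′ 3)
        ≡⟨ lemma X B d L (c′ 2) (c′ 3) (c′ 4) ⟨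
      B * (a₃ * c′ 3 - d * L * a₄ * c′ 2) + (L * a₄ * c′ 4 - a₅ * c′ 3)
        ≡⟨ cong₂ (λ e₂ e₃ → B * e₂ + e₃)
                 (unit-facet₂ a₃⊥dLa₄ G (ℕₚ.<⇒≤ 5≤n)) (unit-facet₃ La₄⊥a₅ G 5≤n) ⟩
      B * 1ℤ + 1ℤ
        ≡⟨ cong (_+ 1ℤ) (ℤₚ.*-identityʳ B) ⟩
      B + 1ℤ ∎)
    where
    open ≡-Reasoning
    open UnitFacets 0<d 0<L 0<a₃ 0<a₄ 0<a₅
    open Coprimality B⊥dL
    c′ = toSeq c
    lemma : ∀ X B d L c₂ c₃ c₄ →
      B * ((X + B) * c₃ - d * L * (X + + 2 * B) * c₂)
        + (L * (X + + 2 * B) * c₄ - (X * X + + 3 * X * B + B * B) * c₃)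
        ≡ (X + + 2 * B) * (L * c₄ - B * d * L * c₂ - X * c₃)
    lemma = solve-∀

module _ {d L B : ℤ} (0<d : 0ℤ < d) (0<L : 0ℤ < L) (B⊥dL : BézoutCoprime B (d * L)) where
  open Recurrence d L B

  private
    0<X : 0ℤ < X
    0<X = *-pos (*-pos 0<d 0<L) 0<L

  not-gorenstein-B>0 : 0ℤ < B → ∀ n → 5 ℕ.≤ n → ¬ IsGorenstein s n
  not-gorenstein-B>0 0<B = not-gorenstein 0<d 0<L 0<a₃ 0<a₄ 0<a₅ B⊥dL
    (λ _ → ¬*≡-between (ℤₚ.+-mono-< 0<B (+<+ (s≤s z≤n))) B+1<a₄)
    where
    0<2B : 0ℤ < + 2 * B
    0<2B = *-pos {+ 2} (+<+ (s≤s z≤n)) 0<B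
    0<a₃ : 0ℤ < a₃
    0<a₃ = ℤₚ.+-mono-< 0<X 0<B
    0<a₄ : 0ℤ < a₄
    0<a₄ = ℤₚ.+-mono-< 0<X 0<2B
    0<a₅ : 0ℤ < a₅
    0<a₅ = ℤₚ.+-mono-< (ℤₚ.+-mono-< (*-pos 0<X 0<X) (*-pos (*-pos {+ 3} (+<+ (s≤s z≤n)) 0<X) 0<B))
                       (*-pos 0<B 0<B)
    B+1<a₄ : B + 1ℤ < a₄
    B+1<a₄ = 0<j-i⇒i<j (subst (0ℤ <_) (lemma X B)
      (ℤₚ.+-mono-<-≤ 0<X (ℤₚ.i≤j⇒0≤j-i (ℤₚ.i<j⇒suc[i]≤j 0<B))))
      where
      lemma : ∀ X B → X + (B - 1ℤ) ≡ X + + 2 * B - (B + 1ℤ)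
      lemma = solve-∀

  not-gorenstein-B≤-2 : 0ℤ ≤ X + + 4 * B → 0ℤ ≤ - B - + 2 → ∀ n → 5 ℕ.≤ n → ¬ IsGorenstein s n
  not-gorenstein-B≤-2 0≤D 0≤β = not-gorenstein 0<d 0<L 0<a₃ 0<a₄ 0<a₅ B⊥dL a₄∤B+1
    where
    0<a₃ : 0ℤ < a₃
    0<a₃ = 0<-by _ (0≤D ⊕ 0≤+ 3 ⊛ 0≤β ⊕ 0≤+ 5) (lemma X B)
      where
      lemma : ∀ X B → X + B ≡ 1ℤ + (X + + 4 * B + + 3 * (- B - + 2) + + 5)
      lemma = solve-∀
    0<a₄ : 0ℤ < a₄
    0<a₄ = 0<-by _ (0≤D ⊕ 0≤+ 2 ⊛ 0≤β ⊕ 0≤+ 3) (lemma X B)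
      where
      lemma : ∀ X B → X + + 2 * B ≡ 1ℤ + (X + + 4 * B + + 2 * (- B - + 2) + + 3)
      lemma = solve-∀
    0<a₅ : 0ℤ < a₅
    0<a₅ = 0<-by _ (  0≤D ⊛ 0≤D ⊕ 0≤+ 5 ⊛ 0≤D ⊛ (0≤β ⊕ 0≤+ 2)
                    ⊕ 0≤+ 5 ⊛ 0≤β ⊛ 0≤β ⊕ 0≤+ 20 ⊛ 0≤β ⊕ 0≤+ 19) (lemma X B)
      where
      lemma : ∀ X B → X * X + + 3 * X * B + B * B
        ≡ 1ℤ + (  (X + + 4 * B) * (X + + 4 * B) + + 5 * (X + + 4 * B) * ((- B - + 2) + + 2)
                + + 5 * (- B - + 2) * (- B - + 2) + + 20 * (- B - + 2) + + 19)
      lemma = solve-∀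
    a₄∤B+1 : ∀ k → a₄ * k ≢ B + 1ℤ
    a₄∤B+1 k a₄k≡B+1 = ¬*≡-between 0<-[B+1] -[B+1]<a₄
      (trans (sym (ℤₚ.neg-distribʳ-* a₄ k)) (cong -_ a₄k≡B+1))
      where
      0<-[B+1] : 0ℤ < - (B + 1ℤ)
      0<-[B+1] = 0<-by _ 0≤β (lemma B)
        where
        lemma : ∀ B → - (B + 1ℤ) ≡ 1ℤ + (- B - + 2)
        lemma = solve-∀
      -[B+1]<a₄ : - (B + 1ℤ) < a₄
      -[B+1]<a₄ = 0<j-i⇒i<j (0<-by _ (0≤D ⊕ 0≤β ⊕ 0≤+ 2) (lemma X B))
        where
        lemma : ∀ X B → X + + 2 * B - - (B + 1ℤ) ≡ 1ℤ + (X + + 4 * B + (- B - + 2) + + 2)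
        lemma = solve-∀

module _ {d L : ℤ} (1<d : 1ℤ < d) (0<L : 0ℤ < L) where
  open Recurrence d L (- 1ℤ)

  private
    0<d : 0ℤ < d
    0<d = ℤₚ.<-trans (+<+ (s≤s z≤n)) 1<d

    a₅⊥a₆ : BézoutCoprime a₅ a₆
    a₅⊥a₆ = coprime-*ʳ (coprime-*ʳ (coprime-*ʳ a₅⊥d a₅⊥L) a₅⊥a₃) a₅⊥X-3
      where
      a₅⊥d : BézoutCoprime a₅ d
      a₅⊥d = coprime-respˡ (lemma d L) (coprime-+* (L * L * X - + 3 * L * L) (1-coprime d))
        where
        lemma : ∀ d L → 1ℤ + d * (L * L * (d * L * L) - + 3 * L * L)
                        ≡ (d * L * L) * (d * L * L) + + 3 * (d * L * L) * - 1ℤ + - 1ℤ * - 1ℤ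
        lemma = solve-∀
      a₅⊥L : BézoutCoprime a₅ L
      a₅⊥L = coprime-respˡ (lemma d L) (coprime-+* (d * L * X - + 3 * d * L) (1-coprime L))
        where
        lemma : ∀ d L → 1ℤ + L * (d * L * (d * L * L) - + 3 * d * L)
                        ≡ (d * L * L) * (d * L * L) + + 3 * (d * L * L) * - 1ℤ + - 1ℤ * - 1ℤ
        lemma = solve-∀
      a₅⊥a₃ : BézoutCoprime a₅ a₃
      a₅⊥a₃ = coprime-respˡ (lemma X) (coprime-+* (X - + 2) (coprime-neg (1-coprime a₃)))
        where
        lemma : ∀ X → - 1ℤ + (X + - 1ℤ) * (X - + 2) ≡ X * X + + 3 * X * - 1ℤ + - 1ℤ * - 1ℤ
        lemma = solve-∀
      a₅⊥X-3 : BézoutCoprime a₅ (X + + 3 * - 1ℤ)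
      a₅⊥X-3 = coprime-respˡ (lemma X) (coprime-+* X (1-coprime (X + + 3 * - 1ℤ)))
        where
        lemma : ∀ X → 1ℤ + (X + + 3 * - 1ℤ) * X ≡ X * X + + 3 * X * - 1ℤ + - 1ℤ * - 1ℤ
        lemma = solve-∀

  not-gorenstein-B≡-1 : 0ℤ ≤ X + + 4 * - 1ℤ → ∀ n → 6 ℕ.≤ n → ¬ IsGorenstein s n
  not-gorenstein-B≡-1 0≤D n 6≤n G@(c , _) =
    ¬*≡-between (i<j⇒0<j-i 1<d) d-1<a₅ (begin
      a₅ * (d * L * c′ 4 - d * c′ 3 - c′ 5)
        ≡⟨ lemma X d L (c′ 3) (c′ 4) (c′ 5) ⟨
      d * (L * a₄ * c′ 4 - a₅ * c′ 3) - (a₅ * c′ 5 - a₆ * c′ 4)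
        ≡⟨ cong₂ (λ e₃ e₄ → d * e₃ - e₄)
                 (unit-facet₃ La₄⊥a₅ G (ℕₚ.<⇒≤ 6≤n)) (unit-facet₄ 0<a₆ a₅⊥a₆ G 6≤n) ⟩
      d * 1ℤ - 1ℤ
        ≡⟨ cong (_- 1ℤ) (ℤₚ.*-identityʳ d) ⟩
      d - 1ℤ ∎)
    where
    open ≡-Reasoning
    0<a₃ : 0ℤ < a₃
    0<a₃ = 0<-by _ (0≤D ⊕ 0≤+ 2) (lemma X)
      where
      lemma : ∀ X → X + - 1ℤ ≡ 1ℤ + (X + + 4 * - 1ℤ + + 2)
      lemma = solve-∀
    0<a₄ : 0ℤ < a₄
    0<a₄ = 0<-by _ (0≤D ⊕ 0≤+ 1) (lemma X)
      where
      lemma : ∀ X → X + + 2 * - 1ℤ ≡ 1ℤ + (X + + 4 * - 1ℤ + 1ℤ)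
      lemma = solve-∀
    0<a₅ : 0ℤ < a₅
    0<a₅ = 0<-by _ (0≤D ⊛ 0≤D ⊕ 0≤+ 5 ⊛ 0≤D ⊕ 0≤+ 4) (lemma X)
      where
      lemma : ∀ X → X * X + + 3 * X * - 1ℤ + - 1ℤ * - 1ℤ
                    ≡ 1ℤ + ((X + + 4 * - 1ℤ) * (X + + 4 * - 1ℤ) + + 5 * (X + + 4 * - 1ℤ) + + 4)
      lemma = solve-∀
    0<a₆ : 0ℤ < a₆
    0<a₆ = *-pos (*-pos (*-pos 0<d 0<L) 0<a₃) (0<-by _ 0≤D (lemma X))
      where
      lemma : ∀ X → X + + 3 * - 1ℤ ≡ 1ℤ + (X + + 4 * - 1ℤ)
      lemma = solve-∀
    d-1<a₅ : d - 1ℤ < a₅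
    d-1<a₅ = ℤₚ.≤-<-trans (ℤₚ.+-monoˡ-≤ (- 1ℤ) d≤X)
      (0<j-i⇒i<j (0<-by _ (0≤D ⊛ 0≤D ⊕ 0≤+ 4 ⊛ 0≤D ⊕ 0≤+ 1) (lemma X)))
      where
      1≤L = ℤₚ.i<j⇒suc[i]≤j 0<L
      d≤X : d ≤ X
      d≤X = ℤₚ.≤-trans (i≤i*j (ℤₚ.<⇒≤ 0<d) 1≤L) (i≤i*j (ℤₚ.<⇒≤ (*-pos 0<d 0<L)) 1≤L)
      lemma : ∀ X → X * X + + 3 * X * - 1ℤ + - 1ℤ * - 1ℤ - (X - 1ℤ)
                    ≡ 1ℤ + ((X + + 4 * - 1ℤ) * (X + + 4 * - 1ℤ) + + 4 * (X + + 4 * - 1ℤ) + 1ℤ)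
      lemma = solve-∀
    open UnitFacets 0<d 0<L 0<a₃ 0<a₄ 0<a₅
    open Coprimality (coprime-neg (1-coprime (d * L)))
    c′ = toSeq c
    lemma : ∀ X d L c₃ c₄ c₅ →
      d * (L * (X + + 2 * - 1ℤ) * c₄ - (X * X + + 3 * X * - 1ℤ + - 1ℤ * - 1ℤ) * c₃)
        - ((X * X + + 3 * X * - 1ℤ + - 1ℤ * - 1ℤ) * c₅ - d * L * (X + - 1ℤ) * (X + + 3 * - 1ℤ) * c₄)
        ≡ (X * X + + 3 * X * - 1ℤ + - 1ℤ * - 1ℤ) * (d * L * c₄ - d * c₃ - c₅)
    lemma = solve-∀

-- Splitting off d = gcd(ℓ, b)

toℤ-+* : ∀ g y n x m → g ℕ.+ y ℕ.* n ≡ x ℕ.* m → + g + + y * + n ≡ + x * + m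
toℤ-+* g y n x m eq = begin
  + g + + y * + n   ≡⟨ cong (λ t → + g + t) (ℤₚ.pos-* y n) ⟨
  + g + + (y ℕ.* n) ≡⟨ ℤₚ.pos-+ g (y ℕ.* n) ⟨
  + (g ℕ.+ y ℕ.* n) ≡⟨ cong +_ eq ⟩
  + (x ℕ.* m)       ≡⟨ ℤₚ.pos-* x m ⟩
  + x * + m         ∎
  where open ≡-Reasoning

bézout-ℕ : ∀ m n → ∃₂ λ x y → x * + m + y * + n ≡ + ℕGCD.gcd m n
bézout-ℕ m n with ℕGCD.Bézout.identity (ℕGCD.gcd-GCD m n)
... | ℕGCD.Bézout.+- x y g+yn≡xm =
  + x , - + y ,
  trans (cong (λ t → t + - + y * + n) (sym (toℤ-+* _ y n x m g+yn≡xm))) (lemma (+ _) (+ y) (+ n))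
  where
  lemma : ∀ g y n → g + y * n + - y * n ≡ g
  lemma = solve-∀
... | ℕGCD.Bézout.-+ x y g+xm≡yn =
  - + x , + y ,
  trans (cong (λ t → - + x * + m + t) (sym (toℤ-+* _ x m y n g+xm≡yn))) (lemma (+ _) (+ x) (+ m))
  where
  lemma : ∀ g x m → - x * m + (g + x * m) ≡ g
  lemma = solve-∀

x*∣i∣≡x′*i : ∀ x i → ∃ λ x′ → x * + ∣ i ∣ ≡ x′ * i
x*∣i∣≡x′*i x i with ℤₚ.+∣i∣≡i⊎+∣i∣≡-i i
... | inj₁ ∣i∣≡i  = x , cong (x *_) ∣i∣≡i
... | inj₂ ∣i∣≡-i = - x , trans (cong (x *_) ∣i∣≡-i)
                              (trans (sym (ℤₚ.neg-distribʳ-* x i)) (ℤₚ.neg-distribˡ-* x i))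

gcd-bézout : ∀ i j → ∃₂ λ x y → x * i + y * j ≡ gcd i j
gcd-bézout i j with bézout-ℕ ∣ i ∣ ∣ j ∣
... | x , y , eq with x*∣i∣≡x′*i x i | x*∣i∣≡x′*i y j
... | x′ , x≡x′ | y′ , y≡y′ = x′ , y′ , trans (cong₂ _+_ (sym x≡x′) (sym y≡y′)) eq

record GcdDecomposition (ℓ b : ℤ) : Set where
  field
    d L B : ℤ
    0<d   : 0ℤ < d
    0<L   : 0ℤ < L
    ℓ≡dL  : ℓ ≡ d * L
    b≡dB  : b ≡ d * B
    B⊥dL  : BézoutCoprime B (d * L)

gcd-decomposition : ∀ ℓ b → 0ℤ < ℓ → gcd ℓ b ≡ gcd (ℓ * ℓ) b → GcdDecomposition ℓ b
gcd-decomposition ℓ b 0<ℓ gcd≡gcd² = record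
  { d = d ; L = L ; B = B ; 0<d = 0<d ; 0<L = 0<L ; ℓ≡dL = ℓ≡dL ; b≡dB = b≡dB ; B⊥dL = B⊥dL }
  where
  d L B : ℤ
  d = gcd ℓ b
  d∣ℓ : d Signed.∣ ℓ
  d∣ℓ = Signed.∣ᵤ⇒∣ {d} {ℓ} (gcd[i,j]∣i ℓ b)
  d∣b : d Signed.∣ b
  d∣b = Signed.∣ᵤ⇒∣ {d} {b} (gcd[i,j]∣j ℓ b)
  L = Signed._∣_.quotient d∣ℓ
  B = Signed._∣_.quotient d∣b
  ℓ≡dL : ℓ ≡ d * L
  ℓ≡dL = trans (Signed._∣_.equality d∣ℓ) (ℤₚ.*-comm L d)
  b≡dB : b ≡ d * B
  b≡dB = trans (Signed._∣_.equality d∣b) (ℤₚ.*-comm B d)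
  0<d : 0ℤ < d
  0<d = ℤₚ.≤∧≢⇒< (+≤+ z≤n)
    (λ 0≡d → ℤₚ.<-irrefl refl (subst (0ℤ <_) (gcd[i,j]≡0⇒i≡0 ℓ b (sym 0≡d)) 0<ℓ))
  0<L : 0ℤ < L
  0<L = ℤₚ.*-cancelˡ-<-nonNeg d ⦃ nonNegative (ℤₚ.<⇒≤ 0<d) ⦄
          (subst₂ _<_ (sym (ℤₚ.*-zeroʳ d)) ℓ≡dL 0<ℓ)
  B⊥dL : BézoutCoprime B (d * L)
  B⊥dL with gcd-bézout (ℓ * ℓ) b
  ... | x , y , bézout-identity = bézout y (x * L)
    (ℤₚ.*-cancelˡ-≡ d _ _ ⦃ >-nonZero 0<d ⦄ (begin
      d * (B * y + d * L * (x * L))         ≡⟨ lemma d L B x y ⟩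
      x * (d * L * (d * L)) + y * (d * B)   ≡⟨ cong₂ (λ ℓ′ b′ → x * (ℓ′ * ℓ′) + y * b′) ℓ≡dL b≡dB ⟨
      x * (ℓ * ℓ) + y * b                   ≡⟨ bézout-identity ⟩
      gcd (ℓ * ℓ) b                         ≡⟨ gcd≡gcd² ⟨
      d                                     ≡⟨ ℤₚ.*-identityʳ d ⟨
      d * 1ℤ                                ∎))
    where
    open ≡-Reasoning
    lemma : ∀ d L B x y → d * (B * y + d * L * (x * L)) ≡ x * (d * L * (d * L)) + y * (d * B)
    lemma = solve-∀

not-gorenstein-factored : ∀ {d L B} → 0ℤ < d → 0ℤ < L → BézoutCoprime B (d * L) → d * B ≢ 0ℤ →
  0ℤ ≤ d * L * L + + 4 * B →
  (0ℤ < d * B → ∀ n → 5 ℕ.≤ n → ¬ IsGorenstein (seqS (d * L) (d * B)) n) ×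
  (d * B < - + 1 → ∀ n → 6 ℕ.≤ n → ¬ IsGorenstein (seqS (d * L) (d * B)) n)
not-gorenstein-factored {d} {B = + 0} _ _ _ dB≢0 _ = ⊥-elim (dB≢0 (ℤₚ.*-zeroʳ d))
not-gorenstein-factored {B = + suc _} 0<d 0<L B⊥dL _ _ =
  (λ _ → not-gorenstein-B>0 0<d 0<L B⊥dL 0<B) ,
  (λ _ n 6≤n → not-gorenstein-B>0 0<d 0<L B⊥dL 0<B n (ℕₚ.<⇒≤ 6≤n))
  where
  0<B = +<+ (s≤s z≤n)
not-gorenstein-factored {d} {B = -[1+ 0 ]} 0<d 0<L _ _ 0≤D =
  (λ 0<-d → ⊥-elim (ℤₚ.<-asym (subst (0ℤ <_) (d*-1≡-d d) 0<-d) (ℤₚ.neg-mono-< 0<d))) ,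
  (λ -d<-1 → not-gorenstein-B≡-1 (ℤₚ.neg-cancel-< (subst (_< - + 1) (d*-1≡-d d) -d<-1)) 0<L 0≤D)
  where
  d*-1≡-d : ∀ d → d * - 1ℤ ≡ - d
  d*-1≡-d = solve-∀
not-gorenstein-factored {B = -[1+ suc _ ]} 0<d 0<L B⊥dL _ 0≤D =
  (λ _ → not-gorenstein-B≤-2 0<d 0<L B⊥dL 0≤D (+≤+ z≤n)) ,
  (λ _ n 6≤n → not-gorenstein-B≤-2 0<d 0<L B⊥dL 0≤D (+≤+ z≤n) n (ℕₚ.<⇒≤ 6≤n))

corollary3p12 : (ℓ b : ℤ) → 0ℤ < ℓ → ¬ (b ≡ 0ℤ) → 0ℤ ≤ ℓ * ℓ + (+ 4) * b →
    gcd ℓ b ≡ gcd (ℓ * ℓ) b →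
    ((0ℤ < b → (n : ℕ) → 5 ≤ℕ n → ¬ IsGorenstein (seqS ℓ b) n) ×
     (b < - (+ 1) → (n : ℕ) → 6 ≤ℕ n → ¬ IsGorenstein (seqS ℓ b) n))
corollary3p12 ℓ b 0<ℓ b≢0 0≤disc gcd≡gcd² =
  (λ 0<b n 5≤n → transport n (proj₁ dLB (subst (0ℤ <_) b≡dB 0<b) n 5≤n)) ,
  (λ b<-1 n 6≤n → transport n (proj₂ dLB (subst (_< - + 1) b≡dB b<-1) n 6≤n))
  where
  open GcdDecomposition (gcd-decomposition ℓ b 0<ℓ gcd≡gcd²)
  transport : ∀ n → ¬ IsGorenstein (seqS (d * L) (d * B)) n → ¬ IsGorenstein (seqS ℓ b) n
  transport n = subst₂ (λ ℓ′ b′ → ¬ IsGorenstein (seqS ℓ′ b′) n) (sym ℓ≡dL) (sym b≡dB)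
  0≤D : 0ℤ ≤ d * L * L + + 4 * B
  0≤D = ℤₚ.*-cancelˡ-≤-pos 0ℤ _ d ⦃ positive 0<d ⦄ (subst₂ _≤_ (sym (ℤₚ.*-zeroʳ d))
    (trans (cong₂ (λ ℓ′ b′ → ℓ′ * ℓ′ + + 4 * b′) ℓ≡dL b≡dB) (lemma d L B)) 0≤disc)
    where
    lemma : ∀ d L B → d * L * (d * L) + + 4 * (d * B) ≡ d * (d * L * L + + 4 * B)
    lemma = solve-∀
  dLB = not-gorenstein-factored 0<d 0<L B⊥dL (b≢0 ∘ trans b≡dB) 0≤D
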